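{- For all formulas $\varphi,\psi$: $\neg\varphi\lor\neg\psi\vdash_{\mathsf{R}'_{\mathrm{BK}}}\neg(\varphi\land\psi)$ and $\varphi\to\psi\vdash_{\mathsf{R}'_{\mathrm{BK}}}\neg(\psi\land\neg\psi)$, where $\alpha\to\beta$ abbreviates $\neg\alpha\lor\beta$.
   Context: Formulas are built from a countably infinite set of variables with binary $\land,\lor$ and unary $\neg$. Set-Fmla Hilbert systems: rule schemas $\gamma_1,\dots,\gamma_m/\varphi$ with all substitution instances; $\Gamma\vdash_{\mathsf R}\varphi$ iff some finite sequence ending in $\varphi$ has each member in $\Gamma$ or the conclusion of a rule instance whose premises occur earlier. The $\lor$-lifted version of a rule $\gamma_1,\dots,\gamma_m/\varphi$ is $s\lor\gamma_1,\dots,s\lor\gamma_m/s\lor\varphi$ with $s$ a variable not occurring in the rule. $\mathsf{R}'_{\mathrm{BK}}$ has rule schemas ($p,q,r$ distinct): (1$\star$) $p,\neg p/q$; (2) $p/\neg\neg p$; (3) $\neg\neg p/p$; (4) $p,q/p\land q$; (5) $\neg p,\neg q/\neg(p\land q)$; (6) $\neg p,q/\neg(p\land q)$; (7) $p,\neg q/\neg(p\land q)$; (8$\star$) $\neg(p\land q)/\neg p\lor p$; (9$\star$) $\neg(p\land q)/\neg q\lor q$; (10) $p\land q/p$; (11) $p\land q/q$; (12) $\neg p,\neg q/\neg(p\lor q)$; (13) $\neg(p\lor q)/\neg p$; (14) $\neg(p\lor q)/\neg q$; (15$\star$) $p\lor q/p\lor\neg p$; (16$\star$) $p\lor q/q\lor\neg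 q$; (17) $\neg p,q/p\lor q$; (18) $p,\neg q/p\lor q$; (19) $p,q/p\lor q$; (20) $p\lor q,\neg p/q$; (21) $p\lor(q\lor r)/(p\lor q)\lor r$; (22) $p\lor p/p$; (23) $p\lor q/q\lor p$; (24) $p\lor q,r/\neg p\lor r$; plus the $\lor$-lifted versions of all these except (1$\star$). -}

module Defs where

open import Data.Nat using (ℕ)
open import Data.List using (List; []; _∷_; map)
open import Data.List.Membership.Propositional using (_∈_)
open import Data.List.Relation.Unary.All using (All)
open import Data.Product using (_×_; Σ; ∃)
open import Data.Sum using (_⊎_)
open import Relation.Binary.PropositionalEquality using (_≡_)
open import Data.Empty using (⊥)
open import Data.Unit using (⊤)

infixr 8 _∧'_
infix 9 ¬'_
infixr 7 _∨'_
data Fml : Set where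
  var  : ℕ → Fml
  _∧'_ : Fml → Fml → Fml
  _∨'_ : Fml → Fml → Fml
  ¬'_  : Fml → Fml

_⇒'_ : Fml → Fml → Fml
α ⇒' β = (¬' α) ∨' β

Subst : Set
Subst = ℕ → Fml

_[_] : Fml → Subst → Fml
var n    [ σ ] = σ n
(a ∧' b) [ σ ] = (a [ σ ]) ∧' (b [ σ ])
(a ∨' b) [ σ ] = (a [ σ ]) ∨' (b [ σ ])
(¬' a)   [ σ ] = ¬' (a [ σ ])

infix 3 _/_
record Rule : Set where
  constructor _/_
  field
    prems : List Fml
    concl : Fml
open Rule public

p q r : Fml
p = var 0
q = var 1
r = var 2

data BaseRule : Rule → Set where
  r1  : BaseRule ((p ∷ ¬' p ∷ []) / q)
  r2  : BaseRule ((p ∷ []) / (¬' ¬' p))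
  r3  : BaseRule ((¬' ¬' p ∷ []) / p)
  r4  : BaseRule ((p ∷ q ∷ []) / (p ∧' q))
  r5  : BaseRule ((¬' p ∷ ¬' q ∷ []) / (¬' (p ∧' q)))
  r6  : BaseRule ((¬' p ∷ q ∷ []) / (¬' (p ∧' q)))
  r7  : BaseRule ((p ∷ ¬' q ∷ []) / (¬' (p ∧' q)))
  r8  : BaseRule ((¬' (p ∧' q) ∷ []) / ((¬' p) ∨' p))
  r9  : BaseRule ((¬' (p ∧' q) ∷ []) / ((¬' q) ∨' q))
  r10 : BaseRule ((p ∧' q ∷ []) / p)
  r11 : BaseRule ((p ∧' q ∷ []) / q)
  r12 : BaseRule ((¬' p ∷ ¬' q ∷ []) / (¬' (p ∨' q)))
  r13 : BaseRule ((¬' (p ∨' q) ∷ []) / (¬' p))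
  r14 : BaseRule ((¬' (p ∨' q) ∷ []) / (¬' q))
  r15 : BaseRule ((p ∨' q ∷ []) / (p ∨' (¬' p)))
  r16 : BaseRule ((p ∨' q ∷ []) / (q ∨' (¬' q)))
  r17 : BaseRule ((¬' p ∷ q ∷ []) / (p ∨' q))
  r18 : BaseRule ((p ∷ ¬' q ∷ []) / (p ∨' q))
  r19 : BaseRule ((p ∷ q ∷ []) / (p ∨' q))
  r20 : BaseRule ((p ∨' q ∷ ¬' p ∷ []) / q)
  r21 : BaseRule ((p ∨' (q ∨' r) ∷ []) / ((p ∨' q) ∨' r))
  r22 : BaseRule ((p ∨' p ∷ []) / p)
  r23 : BaseRule ((p ∨' q ∷ []) / (q ∨' p))
  r24 : BaseRule ((p ∨' q ∷ r ∷ []) / ((¬' p) ∨' r))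

-- ∨-lifted version of a rule, with s a fresh schema variable (var 3 does
-- not occur in any base rule)
s : Fml
s = var 3

lift : Rule → Rule
lift (ps / c) = map (s ∨'_) ps / (s ∨' c)

NotR1 : ∀ {ρ} → BaseRule ρ → Set
NotR1 r1 = ⊥
NotR1 _  = ⊤

data RBK : Rule → Set where
  base   : ∀ {ρ} → BaseRule ρ → RBK ρ
  lifted : ∀ {ρ} (b : BaseRule ρ) → NotR1 b → RBK (lift ρ)

RuleStep : List Fml → Fml → Set
RuleStep earlier φ =
  Σ Rule λ ρ → RBK ρ × Σ Subst λ σ →
    (concl ρ [ σ ] ≡ φ) × All (λ γ → (γ [ σ ]) ∈ earlier) (prems ρ)

-- a derivation from Γ, stored in reverse order (most recent first):
-- every member is in Γ or follows by a rule instance from earlier members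
data IsDerivation (Γ : Fml → Set) : List Fml → Set where
  []  : IsDerivation Γ []
  _∷_ : ∀ {φ ds} → (Γ φ ⊎ RuleStep ds φ) → IsDerivation Γ ds →
        IsDerivation Γ (φ ∷ ds)

_⊢_ : (Fml → Set) → Fml → Set
Γ ⊢ φ = Σ (List Fml) λ ds → IsDerivation Γ (φ ∷ ds)

⟦_⟧ : Fml → Fml → Set
⟦ α ⟧ β = β ≡ α

-- Derivability is closed under rule instances: derivations of the premises can
-- be concatenated, since a rule step stays valid when more formulas precede it.
-- Both entailments are then proofs by cases: the ∨-lifted rules let us reason
-- under a disjunct δ kept as a side formula, which yields the goal γ in the form
-- γ ∨ γ, and rule (22) contracts that to γ.
module Submission where

open import Defs
open import Data.Product using (_×_; _,_; ∃)
open import Data.Sum using (inj₁; inj₂; map₂)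
open import Data.Unit using (tt)
open import Data.List using ([]; _∷_; _++_)
open import Data.List.Relation.Unary.All as All using (All; []; _∷_)
open import Data.List.Relation.Unary.Any using (here)
open import Data.List.Relation.Binary.Subset.Propositional using (_⊆_)
open import Data.List.Membership.Propositional using (_∈_)
open import Data.List.Membership.Propositional.Properties using (∈-++⁺ˡ; ∈-++⁺ʳ)
open import Relation.Binary.PropositionalEquality using (refl)

RuleStep-mono : ∀ {ds es φ} → ds ⊆ es → RuleStep ds φ → RuleStep es φ
RuleStep-mono ds⊆es (ρ , ρ∈R , σ , concl≡φ , prems∈ds) =
  ρ , ρ∈R , σ , concl≡φ , All.map ds⊆es prems∈ds

IsDerivation-++ : ∀ {Γ ds es} →
  IsDerivation Γ ds → IsDerivation Γ es → IsDerivation Γ (ds ++ es)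
IsDerivation-++ []         E = E
IsDerivation-++ (step ∷ D) E =
  map₂ (RuleStep-mono ∈-++⁺ˡ) step ∷ IsDerivation-++ D E

IsDerivation-joint : ∀ {Γ} {A : Set} (f : A → Fml) {xs} →
  All (λ x → Γ ⊢ f x) xs →
  ∃ λ ds → IsDerivation Γ ds × All (λ x → f x ∈ ds) xs
IsDerivation-joint f []                = [] , [] , []
IsDerivation-joint f ((ds , D) ∷ ⊢xs) with IsDerivation-joint f ⊢xs
... | es , E , xs∈es =
  (f _ ∷ ds) ++ es , IsDerivation-++ D E , here refl ∷ All.map (∈-++⁺ʳ (f _ ∷ ds)) xs∈es

assumption : ∀ {Γ φ} → Γ φ → Γ ⊢ φ
assumption γ = [] , inj₁ γ ∷ []

rule : ∀ {Γ ρ} → RBK ρ → (σ : Subst) →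
  All (λ γ → Γ ⊢ (γ [ σ ])) (prems ρ) → Γ ⊢ (concl ρ [ σ ])
rule ρ∈R σ ⊢prems with IsDerivation-joint (_[ σ ]) ⊢prems
... | ds , D , prems∈ds = ds , inj₂ (_ , ρ∈R , σ , refl , prems∈ds) ∷ D

-- Images of p, q and the lifting variable s.
⟨_,_∣_⟩ : Fml → Fml → Fml → Subst
⟨ α , β ∣ δ ⟩ 0 = α
⟨ α , β ∣ δ ⟩ 1 = β
⟨ α , β ∣ δ ⟩ 3 = δ
⟨ α , β ∣ δ ⟩ n = var n

⟨_,_⟩ : Fml → Fml → Subst
⟨ α , β ⟩ = ⟨ α , β ∣ s ⟩

variable
  Γ : Fml → Set
  α β δ : Fml

∨-comm : Γ ⊢ (α ∨' β) → Γ ⊢ (β ∨' α)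
∨-comm d = rule (base r23) ⟨ _ , _ ⟩ (d ∷ [])

∨-idem : Γ ⊢ (α ∨' α) → Γ ⊢ α
∨-idem {α = α} d = rule (base r22) ⟨ α , α ⟩ (d ∷ [])

excluded-middleˡ : Γ ⊢ (α ∨' β) → Γ ⊢ (α ∨' ¬' α)
excluded-middleˡ {β = β} d = rule (base r15) ⟨ _ , β ⟩ (d ∷ [])

excluded-middleʳ : Γ ⊢ (α ∨' β) → Γ ⊢ (β ∨' ¬' β)
excluded-middleʳ {α = α} d = rule (base r16) ⟨ α , _ ⟩ (d ∷ [])

∨-¬¬-intro : Γ ⊢ (δ ∨' α) → Γ ⊢ (δ ∨' ¬' ¬' α)
∨-¬¬-intro {α = α} d = rule (lifted r2 tt) ⟨ α , α ∣ _ ⟩ (d ∷ [])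

∨-¬¬-elim : Γ ⊢ (δ ∨' ¬' ¬' α) → Γ ⊢ (δ ∨' α)
∨-¬¬-elim {α = α} d = rule (lifted r3 tt) ⟨ α , α ∣ _ ⟩ (d ∷ [])

∨-¬∧-intro : Γ ⊢ (δ ∨' ¬' α) → Γ ⊢ (δ ∨' ¬' β) → Γ ⊢ (δ ∨' ¬' (α ∧' β))
∨-¬∧-intro d e = rule (lifted r5 tt) ⟨ _ , _ ∣ _ ⟩ (d ∷ e ∷ [])

∨-¬∧-introˡ : Γ ⊢ (δ ∨' ¬' α) → Γ ⊢ (δ ∨' β) → Γ ⊢ (δ ∨' ¬' (α ∧' β))
∨-¬∧-introˡ d e = rule (lifted r6 tt) ⟨ _ , _ ∣ _ ⟩ (d ∷ e ∷ [])

∨-¬∧-introʳ : Γ ⊢ (δ ∨' α) → Γ ⊢ (δ ∨' ¬' β) → Γ ⊢ (δ ∨' ¬' (α ∧' β))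
∨-¬∧-introʳ d e = rule (lifted r7 tt) ⟨ _ , _ ∣ _ ⟩ (d ∷ e ∷ [])

¬-excluded-middle : Γ ⊢ (¬' α ∨' β) → Γ ⊢ (¬' α ∨' α)
¬-excluded-middle d = ∨-¬¬-elim (excluded-middleˡ d)

¬∨¬⇒¬∧ : Γ ⊢ (¬' α ∨' ¬' β) → Γ ⊢ (¬' (α ∧' β))
¬∨¬⇒¬∧ {Γ} {α} {β} d = ∨-idem (∨-¬∧-intro (∨-comm caseα) (∨-comm caseβ))
  where
  caseα : Γ ⊢ (¬' α ∨' ¬' (α ∧' β))
  caseα = ∨-¬∧-introʳ (¬-excluded-middle d) d
  caseβ : Γ ⊢ (¬' β ∨' ¬' (α ∧' β))
  caseβ = ∨-¬∧-introˡ (∨-comm d) (¬-excluded-middle (∨-comm d))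

⇒-¬∧¬ : Γ ⊢ (α ⇒' β) → Γ ⊢ (¬' (β ∧' ¬' β))
⇒-¬∧¬ {Γ} {α} {β} d = ∨-idem (∨-¬∧-introʳ caseβ (∨-¬¬-intro caseβ))
  where
  β∨¬β : Γ ⊢ (β ∨' ¬' β)
  β∨¬β = excluded-middleʳ d
  caseβ : Γ ⊢ (¬' (β ∧' ¬' β) ∨' β)
  caseβ = ∨-comm (∨-¬∧-introˡ β∨¬β β∨¬β)

proposition7 : ∀ (φ ψ : Fml) →
    (⟦ (¬' φ) ∨' (¬' ψ) ⟧ ⊢ (¬' (φ ∧' ψ))) ×
    (⟦ φ ⇒' ψ ⟧ ⊢ (¬' (ψ ∧' (¬' ψ))))
proposition7 φ ψ = ¬∨¬⇒¬∧ (assumption refl) , ⇒-¬∧¬ (assumption refl)
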